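{- Let $G$ be a finite simple graph of order $n$ having at least one connected component of order greater than two, and let $H$ be a finite simple graph that is not a Roman graph. Then $\gamma_R(G\Box H)\le n\gamma_R(H)-1$.
   Context: $\gamma(X)$ denotes the domination number of a graph $X$ (minimum size of a set $D$ such that every vertex outside $D$ has a neighbor in $D$). A Roman dominating function on $X$ is a map $f:V(X)\to\{0,1,2\}$ such that every vertex $v$ with $f(v)=0$ has a neighbor $u$ with $f(u)=2$; $\gamma_R(X)$ is the minimum of $\sum_v f(v)$ over such $f$. A graph $H$ is Roman if $\gamma_R(H)=2\gamma(H)$. The Cartesian product $G\Box H$ has vertex set $V(G)\times V(H)$, with $(g,h)\sim(g',h')$ iff ($g=g'$ and $h\sim h'$) or ($g\sim g'$ and $h=h'$). -}

module Defs where

open import Data.Nat using (ℕ; zero; suc; _+_; _*_; _≤_)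
open import Data.Fin using (Fin; remQuot)
import Data.Fin as F
open import Data.Bool using (Bool; true; false; if_then_else_; _∧_; _∨_)
open import Data.Product using (Σ; ∃; _×_; _,_; proj₁; proj₂)
open import Relation.Binary.PropositionalEquality using (_≡_; _≢_)
open import Relation.Nullary.Decidable.Core using (does)

AdjRel : ℕ → Set
AdjRel n = Fin n → Fin n → Bool

record Graph (n : ℕ) : Set where
  field
    adj   : AdjRel n
    sym   : ∀ u v → adj u v ≡ adj v u
    irrefl : ∀ v → adj v v ≡ false
open Graph public

sumFin : ∀ {n} → (Fin n → ℕ) → ℕ
sumFin {zero}  f = 0
sumFin {suc n} f = f F.zero + sumFin (λ i → f (F.suc i))

card : ∀ {n} → (Fin n → Bool) → ℕ
card D = sumFin (λ v → if D v then 1 else 0)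

IsDominating : ∀ {n} → AdjRel n → (Fin n → Bool) → Set
IsDominating G D = ∀ v → D v ≡ false → ∃ λ u → D u ≡ true × G v u ≡ true

IsMin : (ℕ → Set) → ℕ → Set
IsMin P k = P k × (∀ j → P j → k ≤ j)

IsDominationNumber : ∀ {n} → AdjRel n → ℕ → Set
IsDominationNumber G = IsMin (λ k → Σ _ λ D → IsDominating G D × card D ≡ k)

IsRDF : ∀ {n} → AdjRel n → (Fin n → ℕ) → Set
IsRDF G f = (∀ v → f v ≤ 2)
          × (∀ v → f v ≡ 0 → ∃ λ u → G v u ≡ true × f u ≡ 2)

IsRomanDominationNumber : ∀ {n} → AdjRel n → ℕ → Set
IsRomanDominationNumber G = IsMin (λ k → Σ _ λ f → IsRDF G f × sumFin f ≡ k)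

IsRoman : ∀ {m} → Graph m → Set
IsRoman H = ∃ λ a → ∃ λ b →
  IsDominationNumber (adj H) a × IsRomanDominationNumber (adj H) b × b ≡ 2 * a

data Reach {n} (G : Graph n) : Fin n → Fin n → Set where
  here : ∀ {v} → Reach G v v
  step : ∀ {u v w} → adj G u v ≡ true → Reach G v w → Reach G u w

HasComponentOfOrderGt2 : ∀ {n} → Graph n → Set
HasComponentOfOrderGt2 G = ∃ λ u → ∃ λ v → ∃ λ w →
  u ≢ v × u ≢ w × v ≢ w × Reach G u v × Reach G u w

-- Cartesian product G □ H on Fin (n * m); vertex i ↔ remQuot m i = (g , h).
cartAdj : ∀ {n m} → Graph n → Graph m → AdjRel (n * m)
cartAdj {n} {m} G H i j with remQuot m i | remQuot m j
... | (g , h) | (g' , h') =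
  (does (g F.≟ g') ∧ adj H h h') ∨ (adj G g g' ∧ does (h F.≟ h'))

-- A graph G with a component of order at least 3 contains a path g₁ g₂ g₃, so
-- it has a Roman dominating function c of weight n − 1 (2 on g₂, 0 on g₁ and g₃,
-- 1 elsewhere). A non-Roman graph H has a minimum Roman dominating function f
-- taking the value 1 at some vertex h₀, since otherwise f⁻¹(2) would be a
-- minimum dominating set of half its weight. Labelling (g, h) of G □ H by f h,
-- except on the layer h = h₀ where it is labelled by c g, is Roman dominating
-- and has weight n (γ_R(H) − 1) + (n − 1).
module Submission where

open import Defs
open import Data.Nat using (ℕ; _≤_; _*_; _∸_)
open import Relation.Nullary using (¬_)

open import Data.Nat using (zero; suc; _+_; z≤n; s≤s; _≟_)
open import Data.Nat.Properties
  using (+-assoc; +-comm; +-identityʳ; *-identityʳ; *-zeroʳ; *-distribˡ-+;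
         +-cancelʳ-≡; *-cancelˡ-≤; m+n∸n≡m; ≤-refl;
         +-commutativeSemigroup)
open import Algebra.Properties.CommutativeSemigroup +-commutativeSemigroup
  using (interchange; xy∙z≈zy∙x)
open import Data.Fin as Fin using (Fin; remQuot; combine; _↑ˡ_; _↑ʳ_)
open import Data.Fin.Properties using (remQuot-combine; combine-remQuot; any?)
open import Data.Bool using (Bool; true; false; if_then_else_; _∧_; _∨_)
open import Data.Bool.Properties using (∨-zeroʳ)
open import Data.Product using (Σ; ∃; _×_; _,_; proj₁; proj₂; uncurry)
open import Data.Sum using (_⊎_; inj₁; inj₂)
open import Data.Empty using (⊥-elim)
open import Data.Vec.Functional using (updateAt)
open import Data.Vec.Functional.Properties using (updateAt-updates; updateAt-minimal)
open import Function using (const; _∘_)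
open import Relation.Nullary using (yes; no; does)
open import Relation.Nullary.Decidable using (dec-true)
open import Relation.Binary.PropositionalEquality
  using (_≡_; _≢_; refl; cong; cong₂; subst; module ≡-Reasoning)
  renaming (sym to ≡-sym; trans to ≡-trans)

sumFin-cong : ∀ {n} {f g : Fin n → ℕ} → (∀ i → f i ≡ g i) → sumFin f ≡ sumFin g
sumFin-cong {zero}  f≗g = refl
sumFin-cong {suc n} f≗g = cong₂ _+_ (f≗g Fin.zero) (sumFin-cong (f≗g ∘ Fin.suc))

sumFin-+ : ∀ {n} (f g : Fin n → ℕ) → sumFin (λ i → f i + g i) ≡ sumFin f + sumFin g
sumFin-+ {zero}  f g = refl
sumFin-+ {suc n} f g =
  ≡-trans (cong (f Fin.zero + g Fin.zero +_) (sumFin-+ (f ∘ Fin.suc) (g ∘ Fin.suc)))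
          (interchange (f Fin.zero) (g Fin.zero) _ _)

sumFin-*ˡ : ∀ {n} k (f : Fin n → ℕ) → sumFin (λ i → k * f i) ≡ k * sumFin f
sumFin-*ˡ {zero}  k f = ≡-sym (*-zeroʳ k)
sumFin-*ˡ {suc n} k f = ≡-trans (cong (k * f Fin.zero +_) (sumFin-*ˡ k (f ∘ Fin.suc)))
                                (≡-sym (*-distribˡ-+ k (f Fin.zero) _))

sumFin-const : ∀ n b → sumFin {n} (const b) ≡ n * b
sumFin-const zero    b = refl
sumFin-const (suc n) b = cong (b +_) (sumFin-const n b)

sumFin-↑ : ∀ a b (f : Fin (a + b) → ℕ) →
  sumFin f ≡ sumFin (λ i → f (i ↑ˡ b)) + sumFin (λ i → f (a ↑ʳ i))
sumFin-↑ zero    b f = refl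
sumFin-↑ (suc a) b f = ≡-trans (cong (f Fin.zero +_) (sumFin-↑ a b (f ∘ Fin.suc)))
                               (≡-sym (+-assoc (f Fin.zero) _ _))

sumFin-combine : ∀ n m (f : Fin (n * m) → ℕ) →
  sumFin f ≡ sumFin (λ g → sumFin (λ h → f (combine {n} {m} g h)))
sumFin-combine zero    m f = refl
sumFin-combine (suc n) m f = ≡-trans (sumFin-↑ m (n * m) f)
  (cong (sumFin (λ h → f (h ↑ˡ n * m)) +_) (sumFin-combine n m (f ∘ (m ↑ʳ_))))

sumFin-updateAt : ∀ {n} (f : Fin n → ℕ) p x →
  sumFin (updateAt f p (const x)) + f p ≡ sumFin f + x
sumFin-updateAt f Fin.zero x = xy∙z≈zy∙x x (sumFin (f ∘ Fin.suc)) (f Fin.zero)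
sumFin-updateAt f (Fin.suc p) x = begin
  (f₀ + U) + f (Fin.suc p)  ≡⟨ +-assoc f₀ U _ ⟩
  f₀ + (U + f (Fin.suc p))  ≡⟨ cong (f₀ +_) (sumFin-updateAt (f ∘ Fin.suc) p x) ⟩
  f₀ + (F + x)              ≡⟨ +-assoc f₀ F x ⟨
  (f₀ + F) + x              ∎
  where
  open ≡-Reasoning
  f₀ = f Fin.zero
  F = sumFin (f ∘ Fin.suc)
  U = sumFin (updateAt (f ∘ Fin.suc) p (const x))

updateAt-const-≤ : ∀ {n k} (f : Fin n → ℕ) p {x} → (∀ q → f q ≤ k) → x ≤ k →
  ∀ q → updateAt f p (const x) q ≤ k
updateAt-const-≤ f p {x} f≤k x≤k q with q Fin.≟ p
... | yes refl rewrite updateAt-updates q {const x} f = x≤k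
... | no q≢p   rewrite updateAt-minimal q p {const x} f q≢p = f≤k q

updateAt-const-≡ : ∀ {n y} (f : Fin n → ℕ) p {x} q →
  updateAt f p (const x) q ≡ y → (q ≡ p × x ≡ y) ⊎ f q ≡ y
updateAt-const-≡ f p {x} q eq with q Fin.≟ p
... | yes refl = inj₁ (refl , ≡-trans (≡-sym (updateAt-updates q {const x} f)) eq)
... | no q≢p   = inj₂ (≡-trans (≡-sym (updateAt-minimal q p f q≢p)) eq)

adj⇒≢ : ∀ {n} (G : Graph n) {u v} → adj G u v ≡ true → u ≢ v
adj⇒≢ G {u} u~u refl with ≡-trans (≡-sym u~u) (irrefl G u)
... | ()

record P₃ {n} (G : Graph n) : Set where
  field
    end₁ centre end₂ : Fin n
    end₁~centre : adj G end₁ centre ≡ true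
    end₂~centre : adj G end₂ centre ≡ true
    end₁≢end₂   : end₁ ≢ end₂

-- The walk must leave {a, b}; the first vertex it reaches outside {a, b} is a
-- second neighbour of a or of b.
P₃-fromWalk : ∀ {n} (G : Graph n) {a b t} → adj G a b ≡ true → Reach G b t →
  t ≢ a → t ≢ b → P₃ G
P₃-fromWalk G a~b here t≢a t≢b = ⊥-elim (t≢b refl)
P₃-fromWalk G {a} {b} a~b (step {v = c} b~c c⇝t) t≢a t≢b with c Fin.≟ a
... | yes refl = P₃-fromWalk G b~c c⇝t t≢b t≢a
... | no c≢a   = record
  { end₁ = a ; centre = b ; end₂ = c
  ; end₁~centre = a~b
  ; end₂~centre = ≡-trans (sym G c b) b~c
  ; end₁≢end₂ = c≢a ∘ ≡-sym
  }

P₃-fromComponent : ∀ {n} (G : Graph n) → HasComponentOfOrderGt2 G → P₃ G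
P₃-fromComponent G (u , v , w , u≢v , u≢w , v≢w , here , u⇝w) = ⊥-elim (u≢v refl)
P₃-fromComponent G (u , v , w , u≢v , u≢w , v≢w , step {v = x} u~x x⇝v , u⇝w)
  with x Fin.≟ v
... | yes refl = P₃-fromWalk G (≡-trans (sym G x u) u~x) u⇝w (v≢w ∘ ≡-sym) (u≢w ∘ ≡-sym)
... | no x≢v   = P₃-fromWalk G u~x x⇝v (u≢v ∘ ≡-sym) (x≢v ∘ ≡-sym)

P₃⇒RDF-ofWeightOrder∸1 : ∀ {n} (G : Graph n) → P₃ G →
  Σ (Fin n → ℕ) λ c → IsRDF (adj G) c × sumFin c + 1 ≡ n
P₃⇒RDF-ofWeightOrder∸1 {n} G P = c , (c≤2 , c≡0⇒dominated) , weight
  where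
  open P₃ P
  c₂ c₃ c : Fin n → ℕ
  c₂ = updateAt (const 1) centre (const 2)
  c₃ = updateAt c₂ end₁ (const 0)
  c  = updateAt c₃ end₂ (const 0)

  centre≢end₁ : centre ≢ end₁
  centre≢end₁ = adj⇒≢ G end₁~centre ∘ ≡-sym
  centre≢end₂ : centre ≢ end₂
  centre≢end₂ = adj⇒≢ G end₂~centre ∘ ≡-sym

  c-centre : c centre ≡ 2
  c-centre = ≡-trans (updateAt-minimal centre end₂ c₃ centre≢end₂)
    (≡-trans (updateAt-minimal centre end₁ c₂ centre≢end₁) (updateAt-updates centre (const 1)))

  c≤2 : ∀ g → c g ≤ 2
  c≤2 = updateAt-const-≤ c₃ end₂ (updateAt-const-≤ c₂ end₁
          (updateAt-const-≤ (const 1) centre (λ _ → s≤s z≤n) ≤-refl) z≤n) z≤n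

  c≡0⇒dominated : ∀ g → c g ≡ 0 → ∃ λ u → adj G g u ≡ true × c u ≡ 2
  c≡0⇒dominated g cg≡0 with updateAt-const-≡ c₃ end₂ g cg≡0
  ... | inj₁ (refl , _) = centre , end₂~centre , c-centre
  ... | inj₂ c₃g≡0 with updateAt-const-≡ c₂ end₁ g c₃g≡0
  ... | inj₁ (refl , _) = centre , end₁~centre , c-centre
  ... | inj₂ c₂g≡0 with updateAt-const-≡ (const 1) centre g c₂g≡0
  ... | inj₁ (_ , ())
  ... | inj₂ ()

  erase : ∀ (f : Fin n → ℕ) p → f p ≡ 1 → sumFin (updateAt f p (const 0)) + 1 ≡ sumFin f
  erase f p fp≡1 = subst (λ v → sumFin (updateAt f p (const 0)) + v ≡ sumFin f) fp≡1
                         (≡-trans (sumFin-updateAt f p 0) (+-identityʳ _))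

  c₂-end₁ : c₂ end₁ ≡ 1
  c₂-end₁ = updateAt-minimal end₁ centre (const 1) (centre≢end₁ ∘ ≡-sym)

  c₃-end₂ : c₃ end₂ ≡ 1
  c₃-end₂ = ≡-trans (updateAt-minimal end₂ end₁ c₂ (end₁≢end₂ ∘ ≡-sym))
                    (updateAt-minimal end₂ centre (const 1) (centre≢end₂ ∘ ≡-sym))

  weight : sumFin c + 1 ≡ n
  weight = +-cancelʳ-≡ 2 _ _ (begin
    sumFin c + 1 + 2          ≡⟨ +-assoc (sumFin c + 1) 1 1 ⟨
    sumFin c + 1 + 1 + 1      ≡⟨ cong (λ s → s + 1 + 1) (erase c₃ end₂ c₃-end₂) ⟩
    sumFin c₃ + 1 + 1         ≡⟨ cong (_+ 1) (erase c₂ end₁ c₂-end₁) ⟩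
    sumFin c₂ + 1             ≡⟨ sumFin-updateAt (const 1) centre 2 ⟩
    sumFin {n} (const 1) + 2  ≡⟨ cong (_+ 2) (≡-trans (sumFin-const n 1) (*-identityʳ n)) ⟩
    n + 2                     ∎)
    where open ≡-Reasoning

twiceOn : ∀ {n} → (Fin n → Bool) → Fin n → ℕ
twiceOn D v = if D v then 2 else 0

sumFin-twiceOn : ∀ {n} (D : Fin n → Bool) → sumFin (twiceOn D) ≡ 2 * card D
sumFin-twiceOn D = ≡-trans (sumFin-cong twice) (sumFin-*ˡ 2 (λ v → if D v then 1 else 0))
  where
  twice : ∀ v → twiceOn D v ≡ 2 * (if D v then 1 else 0)
  twice v with D v
  ... | true  = refl
  ... | false = refl

twiceOn-isRDF : ∀ {n} (G : AdjRel n) {D} → IsDominating G D → IsRDF G (twiceOn D)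
twiceOn-isRDF G {D} D-dom = twiceOn≤2 , dominated
  where
  twiceOn≤2 : ∀ v → twiceOn D v ≤ 2
  twiceOn≤2 v with D v
  ... | true  = ≤-refl
  ... | false = z≤n

  dominated : ∀ v → twiceOn D v ≡ 0 → ∃ λ u → G v u ≡ true × twiceOn D u ≡ 2
  dominated v fv≡0 with D v in Dv
  dominated v ()   | true
  ... | false with D-dom v Dv
  ... | u , Du , v~u = u , v~u , cong (λ b → if b then 2 else 0) Du

romanNumber≤2*card : ∀ {n} (G : AdjRel n) {b D} → IsRomanDominationNumber G b →
  IsDominating G D → b ≤ 2 * card D
romanNumber≤2*card G {D = D} (_ , minimal) D-dom =
  subst (_ ≤_) (sumFin-twiceOn D) (minimal _ (twiceOn D , twiceOn-isRDF G D-dom , refl))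

twoOrZero : ∀ k → k ≤ 2 → k ≢ 1 → k ≡ (if does (k ≟ 2) then 2 else 0)
twoOrZero 0 _ _ = refl
twoOrZero 1 _ k≢1 = ⊥-elim (k≢1 refl)
twoOrZero 2 _ _ = refl
twoOrZero (suc (suc (suc k))) (s≤s (s≤s ())) _

minimumRDF-without1⇒isRoman : ∀ {m} (H : Graph m) {b} → IsRomanDominationNumber (adj H) b →
  ∀ f → IsRDF (adj H) f → sumFin f ≡ b → (∀ h → f h ≢ 1) → IsRoman H
minimumRDF-without1⇒isRoman {m} H {b} bMin f (f≤2 , f-dom) f-weight f≢1 =
  card D , b , ((D , D-dom , refl) , D-minimal) , bMin , b≡2*card
  where
  D : Fin m → Bool
  D h = does (f h ≟ 2)

  f≗twiceOn : ∀ h → f h ≡ twiceOn D h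
  f≗twiceOn h = twoOrZero (f h) (f≤2 h) (f≢1 h)

  D-dom : IsDominating (adj H) D
  D-dom v Dv≡false with f-dom v (≡-trans (f≗twiceOn v) (cong (λ b → if b then 2 else 0) Dv≡false))
  ... | u , v~u , fu≡2 = u , cong (λ k → does (k ≟ 2)) fu≡2 , v~u

  b≡2*card : b ≡ 2 * card D
  b≡2*card = ≡-trans (≡-sym f-weight) (≡-trans (sumFin-cong f≗twiceOn) (sumFin-twiceOn D))

  D-minimal : ∀ j → (Σ _ λ D′ → IsDominating (adj H) D′ × card D′ ≡ j) → card D ≤ j
  D-minimal j (D′ , D′-dom , refl) =
    *-cancelˡ-≤ 2 (subst (_≤ 2 * card D′) b≡2*card (romanNumber≤2*card (adj H) bMin D′-dom))

nonRoman⇒minimumRDF-taking1 : ∀ {m} (H : Graph m) {b} → ¬ IsRoman H →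
  IsRomanDominationNumber (adj H) b →
  Σ (Fin m → ℕ) λ f → IsRDF (adj H) f × sumFin f ≡ b × ∃ λ h → f h ≡ 1
nonRoman⇒minimumRDF-taking1 H nonRoman bMin@((f , f-rdf , f-weight) , _)
  with any? (λ h → f h ≟ 1)
... | yes h₀ = f , f-rdf , f-weight , h₀
... | no ∄h₀ = ⊥-elim (nonRoman
  (minimumRDF-without1⇒isRoman H bMin f f-rdf f-weight (λ h fh≡1 → ∄h₀ (h , fh≡1))))

module _ {n m} (G : Graph n) (H : Graph m) where

  cartAdj-combine : ∀ g h g′ h′ → cartAdj G H (combine g h) (combine g′ h′)
    ≡ (does (g Fin.≟ g′) ∧ adj H h h′) ∨ (adj G g g′ ∧ does (h Fin.≟ h′))
  cartAdj-combine g h g′ h′ =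
    cong₂ adjPairs (remQuot-combine {n} {m} g h) (remQuot-combine {n} {m} g′ h′)
    where
    adjPairs : Fin n × Fin m → Fin n × Fin m → Bool
    adjPairs (g , h) (g′ , h′) = (does (g Fin.≟ g′) ∧ adj H h h′) ∨ (adj G g g′ ∧ does (h Fin.≟ h′))

  cartAdj-fibre : ∀ g {h h′} → adj H h h′ ≡ true →
    cartAdj G H (combine g h) (combine g h′) ≡ true
  cartAdj-fibre g {h} {h′} h~h′
    rewrite cartAdj-combine g h g h′ | dec-true (g Fin.≟ g) refl | h~h′ = refl

  cartAdj-layer : ∀ {g g′} h → adj G g g′ ≡ true →
    cartAdj G H (combine g h) (combine g′ h) ≡ true
  cartAdj-layer {g} {g′} h g~g′
    rewrite cartAdj-combine g h g′ h | g~g′ | dec-true (h Fin.≟ h) refl = ∨-zeroʳ _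

  withLayer : (Fin m → ℕ) → Fin m → (Fin n → ℕ) → Fin (n * m) → ℕ
  withLayer f h₀ c = uncurry (λ g → updateAt f h₀ (const (c g))) ∘ remQuot {n} m

  withLayer-combine : ∀ f h₀ c g h →
    withLayer f h₀ c (combine g h) ≡ updateAt f h₀ (const (c g)) h
  withLayer-combine f h₀ c g h =
    cong (uncurry (λ g → updateAt f h₀ (const (c g)))) (remQuot-combine g h)

  withLayer-weight : ∀ f h₀ c → sumFin (withLayer f h₀ c) + n * f h₀ ≡ n * sumFin f + sumFin c
  withLayer-weight f h₀ c = begin
    sumFin (withLayer f h₀ c) + n * f h₀
      ≡⟨ cong₂ _+_ (≡-trans (sumFin-combine n m _)
                             (sumFin-cong λ g → sumFin-cong (withLayer-combine f h₀ c g)))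
                   (≡-sym (sumFin-const n (f h₀))) ⟩
    sumFin (λ g → sumFin (row g)) + sumFin {n} (const (f h₀))
      ≡⟨ sumFin-+ (sumFin ∘ row) (const (f h₀)) ⟨
    sumFin (λ g → sumFin (row g) + f h₀)
      ≡⟨ sumFin-cong (λ g → sumFin-updateAt f h₀ (c g)) ⟩
    sumFin (λ g → sumFin f + c g)
      ≡⟨ sumFin-+ (const (sumFin f)) c ⟩
    sumFin {n} (const (sumFin f)) + sumFin c
      ≡⟨ cong (_+ sumFin c) (sumFin-const n (sumFin f)) ⟩
    n * sumFin f + sumFin c ∎
    where
    open ≡-Reasoning
    row : Fin n → Fin m → ℕ
    row g = updateAt f h₀ (const (c g))

  withLayer-isRDF : ∀ {f h₀ c} → IsRDF (adj G) c → IsRDF (adj H) f → f h₀ ≢ 2 →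
    IsRDF (cartAdj G H) (withLayer f h₀ c)
  withLayer-isRDF {f} {h₀} {c} (c≤2 , c-dom) (f≤2 , f-dom) fh₀≢2 = Φ≤2 , Φ-dom
    where
    Φ : Fin (n * m) → ℕ
    Φ = withLayer f h₀ c

    Φ≤2 : ∀ i → Φ i ≤ 2
    Φ≤2 i = updateAt-const-≤ f h₀ f≤2 (c≤2 (proj₁ (remQuot {n} m i))) (proj₂ (remQuot {n} m i))

    Φ-domAt : ∀ g h → Φ (combine g h) ≡ 0 →
      ∃ λ j → cartAdj G H (combine g h) j ≡ true × Φ j ≡ 2
    Φ-domAt g h Φgh≡0
      with updateAt-const-≡ f h₀ h (≡-trans (≡-sym (withLayer-combine f h₀ c g h)) Φgh≡0)
    ... | inj₁ (refl , cg≡0) with c-dom g cg≡0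
    ...   | g′ , g~g′ , cg′≡2 = combine g′ h , cartAdj-layer h g~g′ ,
            ≡-trans (withLayer-combine f h₀ c g′ h) (≡-trans (updateAt-updates h f) cg′≡2)
    Φ-domAt g h Φgh≡0 | inj₂ fh≡0 with f-dom h fh≡0
    ...   | h′ , h~h′ , fh′≡2 = combine g h′ , cartAdj-fibre g h~h′ ,
            ≡-trans (withLayer-combine f h₀ c g h′)
                    (≡-trans (updateAt-minimal h′ h₀ f h′≢h₀) fh′≡2)
      where
      h′≢h₀ : h′ ≢ h₀
      h′≢h₀ refl = fh₀≢2 fh′≡2

    Φ-dom : ∀ i → Φ i ≡ 0 → ∃ λ j → cartAdj G H i j ≡ true × Φ j ≡ 2
    Φ-dom i = subst (λ i → Φ i ≡ 0 → ∃ λ j → cartAdj G H i j ≡ true × Φ j ≡ 2)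
                    (combine-remQuot {n} m i)
                    (Φ-domAt (proj₁ (remQuot {n} m i)) (proj₂ (remQuot {n} m i)))

m+n≡o+k⇒k+1≡n⇒m≡o∸1 : ∀ {m n o k} → m + n ≡ o + k → k + 1 ≡ n → m ≡ o ∸ 1
m+n≡o+k⇒k+1≡n⇒m≡o∸1 {m} {n} {o} {k} m+n≡o+k k+1≡n = begin
  m          ≡⟨ m+n∸n≡m m 1 ⟨
  m + 1 ∸ 1  ≡⟨ cong (_∸ 1) (+-cancelʳ-≡ k _ _ m+1+k≡o+k) ⟩
  o ∸ 1      ∎
  where
  open ≡-Reasoning
  m+1+k≡o+k : m + 1 + k ≡ o + k
  m+1+k≡o+k = ≡-trans (+-assoc m 1 k)
                      (≡-trans (cong (m +_) (≡-trans (+-comm 1 k) k+1≡n)) m+n≡o+k)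

corollary14 : ∀ {n m} (G : Graph n) (H : Graph m) →
    HasComponentOfOrderGt2 G → ¬ IsRoman H →
    ∀ a b → IsRomanDominationNumber (cartAdj G H) a →
    IsRomanDominationNumber (adj H) b →
    a ≤ n * b ∸ 1
corollary14 {n} {m} G H component nonRoman a b aMin bMin
  with P₃⇒RDF-ofWeightOrder∸1 G (P₃-fromComponent G component)
     | nonRoman⇒minimumRDF-taking1 H nonRoman bMin
... | c , c-rdf , c-weight | f , f-rdf , f-weight , h₀ , fh₀≡1 =
  subst (a ≤_) (m+n≡o+k⇒k+1≡n⇒m≡o∸1 Φ-weight c-weight)
        (proj₂ aMin _ (Φ , withLayer-isRDF G H c-rdf f-rdf fh₀≢2 , refl))
  where
  Φ : Fin (n * m) → ℕ
  Φ = withLayer G H f h₀ c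

  fh₀≢2 : f h₀ ≢ 2
  fh₀≢2 fh₀≡2 with ≡-trans (≡-sym fh₀≡1) fh₀≡2
  ... | ()

  Φ-weight : sumFin Φ + n ≡ n * b + sumFin c
  Φ-weight = begin
    sumFin Φ + n             ≡⟨ cong (sumFin Φ +_) (*-identityʳ n) ⟨
    sumFin Φ + n * 1         ≡⟨ cong (λ k → sumFin Φ + n * k) fh₀≡1 ⟨
    sumFin Φ + n * f h₀      ≡⟨ withLayer-weight G H f h₀ c ⟩
    n * sumFin f + sumFin c  ≡⟨ cong (λ w → n * w + sumFin c) f-weight ⟩
    n * b + sumFin c         ∎
    where open ≡-Reasoning
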